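{- Let $N=\ell^n$ for a prime $\ell$ and an integer $n\ge1$, and define $S(N)=\sum_{1<k<N,\ 1<\delta_k<\sqrt N}\mu(k)\left(1-\frac{\delta_k^2}{N}\right)$ with $\delta_k=\gcd(k,N)$ and $\mu(k)$ the smallest positive integer such that $\gcd(\mu(k)k-1,N)=1$. Then $S(N)=(\ell^m-1)^2$ if $n=2m+1$, and $S(N)=(\ell^m-1)(\ell^{m+1}-1)$ if $n=2m+2$. -}

module Defs where

open import Data.Nat as ℕ using (ℕ; zero; suc; _<_; _≤_; _*_; _∸_; _<?_)
open import Data.Nat.GCD using (gcd)
open import Data.Integer using (+_)
open import Data.Rational using (ℚ; 0ℚ; 1ℚ; _+_; _-_; _/_)
import Data.Rational as ℚ
open import Data.Bool using (if_then_else_; _∧_)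
open import Data.Product using (_×_)
open import Relation.Binary.PropositionalEquality using (_≡_; _≢_)
open import Relation.Nullary using (does)

ℕ→ℚ : ℕ → ℚ
ℕ→ℚ a = + a / 1

-- a / d as a rational; the case d = 0 is a junk value never used
-- (we only use it with d = N ≥ 2)
frac : ℕ → ℕ → ℚ
frac a zero    = 0ℚ
frac a (suc d) = + a / suc d

sumBelow : ℕ → (ℕ → ℚ) → ℚ
sumBelow zero    f = 0ℚ
sumBelow (suc K) f = sumBelow K f + f K

-- μ is the paper's μ for modulus N: for every 1 < k < N, μ k is the
-- smallest positive integer with gcd (μ k * k - 1, N) = 1.
-- (For k ≥ 2 and m ≥ 1, m * k ∸ 1 is ordinary subtraction.)
IsMu : ℕ → (ℕ → ℕ) → Set
IsMu N μ = ∀ k → 1 < k → k < N →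
  (1 ≤ μ k) × (gcd (μ k * k ∸ 1) N ≡ 1) ×
  (∀ m → 1 ≤ m → m < μ k → gcd (m * k ∸ 1) N ≢ 1)

δ : ℕ → ℕ → ℕ
δ N k = gcd k N

-- S(N) = Σ_{1<k<N, 1<δ_k<√N} μ(k) (1 - δ_k² / N)
-- (for the positive integer δ_k, δ_k < √N ⟺ δ_k² < N)
S : ℕ → (ℕ → ℕ) → ℚ
S N μ = sumBelow N term
  where
  term : ℕ → ℚ
  term k = if does (1 <? k) ∧ does (k <? N) ∧ does (1 <? δ N k) ∧ does (δ N k * δ N k <? N)
           then ℕ→ℚ (μ k) ℚ.* (1ℚ - frac (δ N k * δ N k) N)
           else 0ℚ

-- Write k = ℓ^a·x with ℓ ∤ x. Then δ_k = ℓ^a, and for a ≥ 1 the number k − 1 is prime to ℓ, so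
-- μ(k) = 1. Reading the cofactor x < ℓ^(n−a) in base ℓ, exactly (ℓ − 1)ℓ^(n−a−1) values k < N have
-- valuation a, each contributing 1 − ℓ^(2a−n), which counts only for 1 ≤ a ≤ m. The total
-- (ℓ − 1)(ℓ^(n−a−1) − ℓ^(a−1)) of valuation a telescopes: summing over 1 ≤ a ≤ m gives
-- (ℓ^(n−1) − ℓ^(n−m−1)) − (ℓ^m − 1) = (ℓ^m − 1)(ℓ^(n−m−1) − 1).
module Submission where

open import Defs
open import Data.Nat using (ℕ; _+_; _*_; _^_; _≤_)
open import Data.Nat.Primality using (Prime)
open import Data.Rational using (ℚ; 1ℚ; _-_)
import Data.Rational as ℚ
open import Data.Product using (_×_)
open import Relation.Binary.PropositionalEquality using (_≡_)

open import Data.Bool using (false; if_then_else_; _∧_)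
open import Data.Bool.Properties using (∧-zeroʳ)
open import Data.Empty using (⊥-elim)
open import Data.Integer as ℤ using (+_)
import Data.Integer.Properties as ℤₚ
open import Data.Nat as ℕ using (zero; suc; _<_; _<?_; _∸_; NonZero; z≤n; s≤s)
open import Data.Nat.Coprimality using (Coprime; coprime⇒gcd≡1; coprime-divisor)
open import Data.Nat.Divisibility
  using (_∣_; _∣0; ∣-trans; ∣1⇒≡1; ∣m+n∣m⇒∣n; n∣m*n; m∣m*n; ∣m⇒∣m*n; ∣⇒≤)
open import Data.Nat.GCD using (gcd; c*gcd[m,n]≡gcd[cm,cn])
open import Data.Nat.Primality using (prime⇒irreducible; prime⇒nonZero; prime⇒nonTrivial)
import Data.Nat.Properties as ℕₚ
import Data.Nat.Solver as ℕ-Solver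
open import Data.Product using (_,_)
open import Data.Rational using (0ℚ; toℚᵘ)
import Data.Rational.Properties as ℚₚ
open import Data.Rational.Solver using (module +-*-Solver)
open import Data.Rational.Unnormalised as ℚᵘ using (mkℚᵘ; *≡*)
import Data.Rational.Unnormalised.Properties as ℚᵘₚ
open import Data.Sum using (inj₁; inj₂)
open import Function using (_∘_)
open import Relation.Nullary using (Dec; yes; no; does; ¬_)
open import Relation.Nullary.Decidable using (dec-true; dec-false)
open import Relation.Binary.PropositionalEquality
  using (refl; sym; trans; cong; cong₂; subst; module ≡-Reasoning)

ℕ→ℚ≃mkℚᵘ : ∀ a → toℚᵘ (ℕ→ℚ a) ℚᵘ.≃ mkℚᵘ (+ a) 0
ℕ→ℚ≃mkℚᵘ a = ℚₚ.toℚᵘ-fromℚᵘ (mkℚᵘ (+ a) 0)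

ℕ→ℚ-+ : ∀ a b → ℕ→ℚ (a + b) ≡ ℕ→ℚ a ℚ.+ ℕ→ℚ b
ℕ→ℚ-+ a b = ℚₚ.toℚᵘ-injective (begin
  toℚᵘ (ℕ→ℚ (a + b))                  ≈⟨ ℕ→ℚ≃mkℚᵘ (a + b) ⟩
  mkℚᵘ (+ (a + b)) 0                  ≈⟨ *≡* numerators ⟩
  mkℚᵘ (+ a) 0 ℚᵘ.+ mkℚᵘ (+ b) 0      ≈⟨ ℚᵘₚ.+-cong (ℕ→ℚ≃mkℚᵘ a) (ℕ→ℚ≃mkℚᵘ b) ⟨
  toℚᵘ (ℕ→ℚ a) ℚᵘ.+ toℚᵘ (ℕ→ℚ b)      ≈⟨ ℚₚ.toℚᵘ-homo-+ (ℕ→ℚ a) (ℕ→ℚ b) ⟨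
  toℚᵘ (ℕ→ℚ a ℚ.+ ℕ→ℚ b)              ∎)
  where
  open ℚᵘₚ.≃-Reasoning
  numerators : + (a + b) ℤ.* + 1 ≡ (+ a ℤ.* + 1 ℤ.+ + b ℤ.* + 1) ℤ.* + 1
  numerators rewrite ℤₚ.*-identityʳ (+ a) | ℤₚ.*-identityʳ (+ b) | ℤₚ.*-identityʳ (+ a ℤ.+ + b) = refl

ℕ→ℚ-* : ∀ a b → ℕ→ℚ (a * b) ≡ ℕ→ℚ a ℚ.* ℕ→ℚ b
ℕ→ℚ-* a b = ℚₚ.toℚᵘ-injective (begin
  toℚᵘ (ℕ→ℚ (a * b))                  ≈⟨ ℕ→ℚ≃mkℚᵘ (a * b) ⟩
  mkℚᵘ (+ (a * b)) 0                  ≈⟨ *≡* (cong (ℤ._* + 1) (ℤₚ.pos-* a b)) ⟩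
  mkℚᵘ (+ a) 0 ℚᵘ.* mkℚᵘ (+ b) 0      ≈⟨ ℚᵘₚ.*-cong (ℕ→ℚ≃mkℚᵘ a) (ℕ→ℚ≃mkℚᵘ b) ⟨
  toℚᵘ (ℕ→ℚ a) ℚᵘ.* toℚᵘ (ℕ→ℚ b)      ≈⟨ ℚₚ.toℚᵘ-homo-* (ℕ→ℚ a) (ℕ→ℚ b) ⟨
  toℚᵘ (ℕ→ℚ a ℚ.* ℕ→ℚ b)              ∎)
  where open ℚᵘₚ.≃-Reasoning

ℕ→ℚ-suc : ∀ a → ℕ→ℚ (suc a) ≡ ℕ→ℚ a ℚ.+ 1ℚ
ℕ→ℚ-suc a = trans (cong ℕ→ℚ (ℕₚ.+-comm 1 a)) (ℕ→ℚ-+ a 1)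

ℕ→ℚ-*-frac : ∀ y x z d .{{_ : NonZero d}} → y * x ≡ z * d → ℕ→ℚ y ℚ.* frac x d ≡ ℕ→ℚ z
ℕ→ℚ-*-frac y x z (suc d) yx≡zd = ℚₚ.toℚᵘ-injective (let open ℚᵘₚ.≃-Reasoning in begin
  toℚᵘ (ℕ→ℚ y ℚ.* frac x (suc d))            ≈⟨ ℚₚ.toℚᵘ-homo-* (ℕ→ℚ y) (frac x (suc d)) ⟩
  toℚᵘ (ℕ→ℚ y) ℚᵘ.* toℚᵘ (frac x (suc d))   ≈⟨ ℚᵘₚ.*-cong (ℕ→ℚ≃mkℚᵘ y) (ℚₚ.toℚᵘ-fromℚᵘ (mkℚᵘ (+ x) d)) ⟩
  mkℚᵘ (+ y) 0 ℚᵘ.* mkℚᵘ (+ x) d            ≈⟨ *≡* cross ⟩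
  mkℚᵘ (+ z) 0                              ≈⟨ ℕ→ℚ≃mkℚᵘ z ⟨
  toℚᵘ (ℕ→ℚ z)                              ∎)
  where
  cross : (+ y ℤ.* + x) ℤ.* + 1 ≡ + z ℤ.* + (1 * suc d)
  cross = begin
    (+ y ℤ.* + x) ℤ.* + 1  ≡⟨ ℤₚ.*-identityʳ _ ⟩
    + y ℤ.* + x            ≡⟨ ℤₚ.pos-* y x ⟨
    + (y * x)              ≡⟨ cong +_ (trans yx≡zd (cong (z *_) (sym (ℕₚ.*-identityˡ (suc d))))) ⟩
    + (z * (1 * suc d))    ≡⟨ ℤₚ.pos-* z (1 * suc d) ⟩
    + z ℤ.* + (1 * suc d)  ∎
    where open ≡-Reasoning

sumBelow-cong : ∀ K {f g : ℕ → ℚ} → (∀ i → i < K → f i ≡ g i) → sumBelow K f ≡ sumBelow K g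
sumBelow-cong zero    f≡g = refl
sumBelow-cong (suc K) f≡g =
  cong₂ ℚ._+_ (sumBelow-cong K (λ i i<K → f≡g i (ℕₚ.m<n⇒m<1+n i<K))) (f≡g K (ℕₚ.n<1+n K))

sumBelow-+ : ∀ a b (f : ℕ → ℚ) → sumBelow (a + b) f ≡ sumBelow a f ℚ.+ sumBelow b (λ i → f (a + i))
sumBelow-+ a zero    f = trans (cong (λ K → sumBelow K f) (ℕₚ.+-identityʳ a)) (sym (ℚₚ.+-identityʳ _))
sumBelow-+ a (suc b) f = begin
  sumBelow (a + suc b) f
    ≡⟨ cong (λ K → sumBelow K f) (ℕₚ.+-suc a b) ⟩
  sumBelow (a + b) f ℚ.+ f (a + b)
    ≡⟨ cong (ℚ._+ f (a + b)) (sumBelow-+ a b f) ⟩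
  (sumBelow a f ℚ.+ sumBelow b (λ i → f (a + i))) ℚ.+ f (a + b)
    ≡⟨ ℚₚ.+-assoc (sumBelow a f) _ (f (a + b)) ⟩
  sumBelow a f ℚ.+ sumBelow (suc b) (λ i → f (a + i)) ∎
  where open ≡-Reasoning

sumBelow-* : ∀ M L (f : ℕ → ℚ) → sumBelow (M * L) f ≡ sumBelow M (λ q → sumBelow L (λ r → f (q * L + r)))
sumBelow-* zero    L f = refl
sumBelow-* (suc M) L f = begin
  sumBelow (L + M * L) f
    ≡⟨ cong (λ K → sumBelow K f) (ℕₚ.+-comm L (M * L)) ⟩
  sumBelow (M * L + L) f
    ≡⟨ sumBelow-+ (M * L) L f ⟩
  sumBelow (M * L) f ℚ.+ sumBelow L (λ r → f (M * L + r))
    ≡⟨ cong (ℚ._+ sumBelow L (λ r → f (M * L + r))) (sumBelow-* M L f) ⟩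
  sumBelow (suc M) (λ q → sumBelow L (λ r → f (q * L + r))) ∎
  where open ≡-Reasoning

sumBelow-suc : ∀ K (f : ℕ → ℚ) → sumBelow (suc K) f ≡ f 0 ℚ.+ sumBelow K (λ i → f (suc i))
sumBelow-suc zero    f = ℚₚ.+-comm 0ℚ (f 0)
sumBelow-suc (suc K) f = trans (cong (ℚ._+ f (suc K)) (sumBelow-suc K f)) (ℚₚ.+-assoc (f 0) _ _)

sumBelow-distrib : ∀ K (f g : ℕ → ℚ) → sumBelow K (λ i → f i ℚ.+ g i) ≡ sumBelow K f ℚ.+ sumBelow K g
sumBelow-distrib zero    f g = refl
sumBelow-distrib (suc K) f g =
  trans (cong (ℚ._+ (f K ℚ.+ g K)) (sumBelow-distrib K f g))
        (solve 4 (λ a b c d → (a :+ b) :+ (c :+ d) := (a :+ c) :+ (b :+ d)) refl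
               (sumBelow K f) (sumBelow K g) (f K) (g K))
  where open +-*-Solver

sumBelow-const : ∀ K c → sumBelow K (λ _ → c) ≡ ℕ→ℚ K ℚ.* c
sumBelow-const zero    c = sym (ℚₚ.*-zeroˡ c)
sumBelow-const (suc K) c = begin
  sumBelow K (λ _ → c) ℚ.+ c   ≡⟨ cong (ℚ._+ c) (sumBelow-const K c) ⟩
  ℕ→ℚ K ℚ.* c ℚ.+ c           ≡⟨ solve 2 (λ k c → k :* c :+ c := (k :+ con 1ℚ) :* c) refl (ℕ→ℚ K) c ⟩
  (ℕ→ℚ K ℚ.+ 1ℚ) ℚ.* c        ≡⟨ cong (ℚ._* c) (ℕ→ℚ-suc K) ⟨
  ℕ→ℚ (suc K) ℚ.* c           ∎
  where
  open ≡-Reasoning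
  open +-*-Solver

coprime-* : ∀ {x a b} → Coprime x a → Coprime x b → Coprime x (a * b)
coprime-* x⊥a x⊥b (d∣x , d∣ab) =
  x⊥b (d∣x , coprime-divisor (λ (e∣d , e∣a) → x⊥a (∣-trans e∣d d∣x , e∣a)) d∣ab)

coprime-^ : ∀ {x a} → Coprime x a → ∀ k → Coprime x (a ^ k)
coprime-^ x⊥a zero    (_ , d∣1) = ∣1⇒≡1 d∣1
coprime-^ x⊥a (suc k) = coprime-* x⊥a (coprime-^ x⊥a k)

prime∤⇒coprime : ∀ {p x} → Prime p → ¬ p ∣ x → Coprime x p
prime∤⇒coprime p-prime p∤x (d∣x , d∣p) with prime⇒irreducible p-prime d∣p
... | inj₁ d≡1  = d≡1
... | inj₂ refl = ⊥-elim (p∤x d∣x)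

gcd[p^a*x,p^[a+k]]≡p^a : ∀ {p x} → Prime p → ¬ p ∣ x → ∀ a k → gcd (p ^ a * x) (p ^ (a + k)) ≡ p ^ a
gcd[p^a*x,p^[a+k]]≡p^a {p} {x} p-prime p∤x a k = begin
  gcd (p ^ a * x) (p ^ (a + k))      ≡⟨ cong (gcd (p ^ a * x)) (ℕₚ.^-distribˡ-+-* p a k) ⟩
  gcd (p ^ a * x) (p ^ a * p ^ k)    ≡⟨ c*gcd[m,n]≡gcd[cm,cn] (p ^ a) x (p ^ k) ⟨
  p ^ a * gcd x (p ^ k)              ≡⟨ cong (p ^ a *_) (coprime⇒gcd≡1 x⊥p^k) ⟩
  p ^ a * 1                          ≡⟨ ℕₚ.*-identityʳ (p ^ a) ⟩
  p ^ a                              ∎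
  where
  open ≡-Reasoning
  x⊥p^k : Coprime x (p ^ k)
  x⊥p^k = coprime-^ (prime∤⇒coprime p-prime p∤x) k

μ≡1 : ∀ {N μ k} → IsMu N μ → 1 < k → k < N → gcd (k ∸ 1) N ≡ 1 → μ k ≡ 1
μ≡1 {N} {μ} {k} μ-spec 1<k k<N gcd[k-1,N]≡1 with μ k | μ-spec k 1<k k<N
... | suc zero        | _ = refl
... | suc (suc _)     | _ , _ , minimal =
  ⊥-elim (minimal 1 ℕₚ.≤-refl (s≤s (s≤s z≤n))
           (subst (λ j → gcd (j ∸ 1) N ≡ 1) (sym (ℕₚ.*-identityˡ k)) gcd[k-1,N]≡1))

-- Verbatim the summand in the definition of S, so that S N μ unfolds to sumBelow N (S-summand N μ).
S-summand : ℕ → (ℕ → ℕ) → ℕ → ℚ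
S-summand N μ k = if does (1 <? k) ∧ does (k <? N) ∧ does (1 <? δ N k) ∧ does (δ N k * δ N k <? N)
                  then ℕ→ℚ (μ k) ℚ.* (1ℚ - frac (δ N k * δ N k) N)
                  else 0ℚ

weight : ℕ → ℕ → ℚ
weight N d = if does (1 <? d) ∧ does (d * d <? N) then 1ℚ - frac (d * d) N else 0ℚ

guarded-cong : ∀ {A B C D : Set} (a? : Dec A) (b? : Dec B) (c? : Dec C) (d? : Dec D) {x y : ℚ} →
  B → (C → A) → (C → x ≡ y) →
  (if does a? ∧ does b? ∧ does c? ∧ does d? then x else 0ℚ) ≡ (if does c? ∧ does d? then y else 0ℚ)
guarded-cong (yes _) (yes _) (yes c) d? _ _   x≡y = cong (λ z → if does d? then z else 0ℚ) (x≡y c)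
guarded-cong (yes _) (yes _) (no _)  d? _ _   _   = refl
guarded-cong (yes _) (no ¬b) c?      d? b _   _   = ⊥-elim (¬b b)
guarded-cong (no ¬a) b?      (yes c) d? _ c⇒a _   = ⊥-elim (¬a (c⇒a c))
guarded-cong (no _)  b?      (no _)  d? _ _   _   = refl

S-summand≡weight : ∀ {N μ k} → k < N → (1 < δ N k → 1 < k) → (1 < δ N k → μ k ≡ 1) →
                   S-summand N μ k ≡ weight N (δ N k)
S-summand≡weight {N} {μ} {k} k<N 1<k μk≡1 =
  guarded-cong (1 <? k) (k <? N) (1 <? δ N k) (δ N k * δ N k <? N) k<N 1<k
    (λ 1<δ → trans (cong (λ j → ℕ→ℚ j ℚ.* _) (μk≡1 1<δ)) (ℚₚ.*-identityˡ _))

weight-inside : ∀ {N d} → 1 < d → d * d < N → weight N d ≡ 1ℚ - frac (d * d) N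
weight-inside {N} {d} 1<d d²<N =
  cong₂ (λ b c → if b ∧ c then 1ℚ - frac (d * d) N else 0ℚ)
        (dec-true (1 <? d) 1<d) (dec-true (d * d <? N) d²<N)

weight-outside : ∀ {N d} → ¬ d * d < N → weight N d ≡ 0ℚ
weight-outside {N} {d} d²≮N = begin
  weight N d
    ≡⟨ cong (λ c → if does (1 <? d) ∧ c then X else 0ℚ) (dec-false (d * d <? N) d²≮N) ⟩
  (if does (1 <? d) ∧ false then X else 0ℚ)
    ≡⟨ cong (λ b → if b then X else 0ℚ) (∧-zeroʳ (does (1 <? d))) ⟩
  0ℚ ∎
  where
  open ≡-Reasoning
  X = 1ℚ - frac (d * d) N

μ≡1-on-multiples : ∀ {p n μ k} → Prime p → IsMu (p ^ n) μ → 1 < k → k < p ^ n → p ∣ k → μ k ≡ 1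
μ≡1-on-multiples {p} {n} {μ} {k} p-prime μ-spec 1<k k<N p∣k =
  μ≡1 μ-spec 1<k k<N (coprime⇒gcd≡1 (coprime-^ (prime∤⇒coprime p-prime p∤k-1) n))
  where
  p∤k-1 : ¬ p ∣ k ∸ 1
  p∤k-1 p∣k-1 = ℕ.nonTrivial⇒≢1 {{prime⇒nonTrivial p-prime}}
    (∣1⇒≡1 (∣m+n∣m⇒∣n (subst (p ∣_) (sym (ℕₚ.m∸n+n≡m (ℕₚ.<⇒≤ 1<k))) p∣k) p∣k-1))

m∤q*m+r : ∀ {m} q r → 0 < r → r < m → ¬ m ∣ q * m + r
m∤q*m+r {m} q (suc r) _ r<m m∣q*m+r = ℕₚ.<⇒≱ r<m (∣⇒≤ (∣m+n∣m⇒∣n m∣q*m+r (n∣m*n q)))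

q*m+r<M*m : ∀ {q r m M} → q < M → r < m → q * m + r < M * m
q*m+r<M*m {q} {r} {m} {M} q<M r<m = begin-strict
  q * m + r   <⟨ ℕₚ.+-monoʳ-< (q * m) r<m ⟩
  q * m + m   ≡⟨ ℕₚ.+-comm (q * m) m ⟩
  suc q * m   ≤⟨ ℕₚ.*-monoˡ-≤ m q<M ⟩
  M * m       ∎
  where open ℕₚ.≤-Reasoning

module PrimePower (ℓ-1 : ℕ) (ℓ-prime : Prime (suc ℓ-1))
                  (n : ℕ) (μ : ℕ → ℕ) (μ-spec : IsMu (suc ℓ-1 ^ n) μ) where

  ℓ : ℕ
  ℓ = suc ℓ-1

  N : ℕ
  N = ℓ ^ n

  1<ℓ : 1 < ℓ
  1<ℓ = ℕ.nonTrivial⇒n>1 ℓ {{prime⇒nonTrivial ℓ-prime}}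

  ℓ∣ℓ^a*x : ∀ a x → 1 < ℓ ^ a → ℓ ∣ ℓ ^ a * x
  ℓ∣ℓ^a*x zero    x (s≤s ())
  ℓ∣ℓ^a*x (suc a) x _ = ∣m⇒∣m*n x (m∣m*n (ℓ ^ a))

  S-summand-at-valuation : ∀ a b x → a + b ≡ n → ¬ ℓ ∣ x → x < ℓ ^ b →
                           S-summand N μ (ℓ ^ a * x) ≡ weight N (ℓ ^ a)
  S-summand-at-valuation a b x a+b≡n ℓ∤x x<ℓ^b =
    subst (λ d → S-summand N μ k ≡ weight N d) δ≡ℓ^a
      (S-summand≡weight {μ = μ} k<N (1<k ∘ 1<ℓ^a)
        (λ 1<δ → μ≡1-on-multiples {n = n} ℓ-prime μ-spec (1<k (1<ℓ^a 1<δ)) k<N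
                   (ℓ∣ℓ^a*x a x (1<ℓ^a 1<δ))))
    where
    k = ℓ ^ a * x
    δ≡ℓ^a : δ N k ≡ ℓ ^ a
    δ≡ℓ^a = trans (cong (gcd k ∘ (ℓ ^_)) (sym a+b≡n)) (gcd[p^a*x,p^[a+k]]≡p^a ℓ-prime ℓ∤x a b)
    1<ℓ^a : 1 < δ N k → 1 < ℓ ^ a
    1<ℓ^a = subst (1 <_) δ≡ℓ^a
    k<N : k < N
    k<N = subst (k <_) (trans (sym (ℕₚ.^-distribˡ-+-* ℓ a b)) (cong (ℓ ^_) a+b≡n))
                (ℕₚ.*-monoʳ-< (ℓ ^ a) {{ℕₚ.m^n≢0 ℓ a}} x<ℓ^b)
    1<k : 1 < ℓ ^ a → 1 < k
    1<k 1<ℓ^a = ℕₚ.<-≤-trans 1<ℓ^a (ℕₚ.m≤m*n (ℓ ^ a) x {{ℕ.≢-nonZero (λ { refl → ℓ∤x (ℓ ∣0) })}})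

  sumOverMultiples : ℕ → ℕ → ℚ
  sumOverMultiples a b = sumBelow (ℓ ^ b) (λ q → S-summand N μ (ℓ ^ a * q))

  sumOverDigits : ∀ a b → a + suc b ≡ n → ∀ q → q < ℓ ^ b →
    sumBelow ℓ (λ r → S-summand N μ (ℓ ^ a * (q * ℓ + r)))
      ≡ S-summand N μ (ℓ ^ suc a * q) ℚ.+ ℕ→ℚ ℓ-1 ℚ.* weight N (ℓ ^ a)
  sumOverDigits a b a+1+b≡n q q<ℓ^b = begin
    sumBelow ℓ (λ r → S-summand N μ (ℓ ^ a * (q * ℓ + r)))
      ≡⟨ sumBelow-suc ℓ-1 _ ⟩
    S-summand N μ (ℓ ^ a * (q * ℓ + 0)) ℚ.+ sumBelow ℓ-1 (λ r → S-summand N μ (ℓ ^ a * (q * ℓ + suc r)))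
      ≡⟨ cong₂ ℚ._+_ (cong (S-summand N μ) shift) (sumBelow-cong ℓ-1 nonzeroDigit) ⟩
    S-summand N μ (ℓ ^ suc a * q) ℚ.+ sumBelow ℓ-1 (λ _ → weight N (ℓ ^ a))
      ≡⟨ cong (S-summand N μ (ℓ ^ suc a * q) ℚ.+_) (sumBelow-const ℓ-1 (weight N (ℓ ^ a))) ⟩
    S-summand N μ (ℓ ^ suc a * q) ℚ.+ ℕ→ℚ ℓ-1 ℚ.* weight N (ℓ ^ a) ∎
    where
    open ≡-Reasoning
    shift : ℓ ^ a * (q * ℓ + 0) ≡ ℓ ^ suc a * q
    shift = solve 3 (λ x q l → x :* (q :* l :+ con 0) := (l :* x) :* q) refl (ℓ ^ a) q ℓ
      where open ℕ-Solver.+-*-Solver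
    nonzeroDigit : ∀ r → r < ℓ-1 → S-summand N μ (ℓ ^ a * (q * ℓ + suc r)) ≡ weight N (ℓ ^ a)
    nonzeroDigit r r<ℓ-1 =
      S-summand-at-valuation a (suc b) (q * ℓ + suc r) a+1+b≡n
        (m∤q*m+r q (suc r) (s≤s z≤n) (s≤s r<ℓ-1))
        (subst (q * ℓ + suc r <_) (ℕₚ.*-comm (ℓ ^ b) ℓ) (q*m+r<M*m q<ℓ^b (s≤s r<ℓ-1)))

  sumOverMultiples-suc : ∀ a b → a + suc b ≡ n →
    sumOverMultiples a (suc b)
      ≡ sumOverMultiples (suc a) b ℚ.+ ℕ→ℚ (ℓ ^ b) ℚ.* (ℕ→ℚ ℓ-1 ℚ.* weight N (ℓ ^ a))
  sumOverMultiples-suc a b a+1+b≡n = begin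
    sumBelow (ℓ * ℓ ^ b) F
      ≡⟨ cong (λ K → sumBelow K F) (ℕₚ.*-comm ℓ (ℓ ^ b)) ⟩
    sumBelow (ℓ ^ b * ℓ) F
      ≡⟨ sumBelow-* (ℓ ^ b) ℓ F ⟩
    sumBelow (ℓ ^ b) (λ q → sumBelow ℓ (λ r → F (q * ℓ + r)))
      ≡⟨ sumBelow-cong (ℓ ^ b) (sumOverDigits a b a+1+b≡n) ⟩
    sumBelow (ℓ ^ b) (λ q → S-summand N μ (ℓ ^ suc a * q) ℚ.+ c)
      ≡⟨ sumBelow-distrib (ℓ ^ b) _ _ ⟩
    sumOverMultiples (suc a) b ℚ.+ sumBelow (ℓ ^ b) (λ _ → c)
      ≡⟨ cong (sumOverMultiples (suc a) b ℚ.+_) (sumBelow-const (ℓ ^ b) c) ⟩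
    sumOverMultiples (suc a) b ℚ.+ ℕ→ℚ (ℓ ^ b) ℚ.* c ∎
    where
    open ≡-Reasoning
    F : ℕ → ℚ
    F q = S-summand N μ (ℓ ^ a * q)
    c = ℕ→ℚ ℓ-1 ℚ.* weight N (ℓ ^ a)

  sumOverMultiples-vanish : ∀ a b → a + b ≡ n → n ≤ a + a → sumOverMultiples a b ≡ 0ℚ
  sumOverMultiples-vanish a zero    _       _ = cong (λ k → 0ℚ ℚ.+ S-summand N μ k) (ℕₚ.*-zeroʳ (ℓ ^ a))
  sumOverMultiples-vanish a (suc b) a+1+b≡n n≤2a = begin
    sumOverMultiples a (suc b)
      ≡⟨ sumOverMultiples-suc a b a+1+b≡n ⟩
    sumOverMultiples (suc a) b ℚ.+ ℕ→ℚ (ℓ ^ b) ℚ.* (ℕ→ℚ ℓ-1 ℚ.* weight N (ℓ ^ a))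
      ≡⟨ cong₂ (λ s w → s ℚ.+ ℕ→ℚ (ℓ ^ b) ℚ.* (ℕ→ℚ ℓ-1 ℚ.* w))
               (sumOverMultiples-vanish (suc a) b (trans (sym (ℕₚ.+-suc a b)) a+1+b≡n) n≤2[a+1])
               (weight-outside {d = ℓ ^ a} ℓ^2a≮N) ⟩
    0ℚ ℚ.+ ℕ→ℚ (ℓ ^ b) ℚ.* (ℕ→ℚ ℓ-1 ℚ.* 0ℚ)
      ≡⟨ solve 2 (λ x y → con 0ℚ :+ x :* (y :* con 0ℚ) := con 0ℚ) refl (ℕ→ℚ (ℓ ^ b)) (ℕ→ℚ ℓ-1) ⟩
    0ℚ ∎
    where
    open ≡-Reasoning
    open +-*-Solver
    n≤2[a+1] : n ≤ suc a + suc a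
    n≤2[a+1] = ℕₚ.≤-trans n≤2a (ℕₚ.+-mono-≤ (ℕₚ.n≤1+n a) (ℕₚ.n≤1+n a))
    ℓ^2a≮N : ¬ ℓ ^ a * ℓ ^ a < N
    ℓ^2a≮N ℓ^2a<N = ℕₚ.<⇒≱ ℓ^2a<N (subst (N ≤_) (ℕₚ.^-distribˡ-+-* ℓ a a) (ℕₚ.^-monoʳ-≤ ℓ n≤2a))

  ℕ→ℚ-ℓ^suc : ∀ j → ℕ→ℚ (ℓ ^ suc j) ≡ (ℕ→ℚ ℓ-1 ℚ.+ 1ℚ) ℚ.* ℕ→ℚ (ℓ ^ j)
  ℕ→ℚ-ℓ^suc j = trans (ℕ→ℚ-* ℓ (ℓ ^ j)) (cong (ℚ._* ℕ→ℚ (ℓ ^ j)) (ℕ→ℚ-suc ℓ-1))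

  valuation-contribution : ∀ a b → suc a + suc b ≡ n → suc a + suc a < n →
    ℕ→ℚ (ℓ ^ b) ℚ.* (ℕ→ℚ ℓ-1 ℚ.* weight N (ℓ ^ suc a)) ≡ ℕ→ℚ ℓ-1 ℚ.* (ℕ→ℚ (ℓ ^ b) - ℕ→ℚ (ℓ ^ a))
  valuation-contribution a b a+b+2≡n 2a+2<n = begin
    X ℚ.* (l ℚ.* weight N (ℓ ^ suc a))
      ≡⟨ cong (λ w → X ℚ.* (l ℚ.* w)) (weight-inside 1<ℓ^[a+1] ℓ^[2a+2]<N) ⟩
    X ℚ.* (l ℚ.* (1ℚ - F))
      ≡⟨ distribute X l F ⟩
    l ℚ.* (X - X ℚ.* F)
      ≡⟨ cong (λ y → l ℚ.* (X - y)) (ℕ→ℚ-*-frac (ℓ ^ b) _ (ℓ ^ a) N {{ℕₚ.m^n≢0 ℓ n}} powers) ⟩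
    l ℚ.* (X - ℕ→ℚ (ℓ ^ a)) ∎
    where
    open ≡-Reasoning
    X = ℕ→ℚ (ℓ ^ b)
    l = ℕ→ℚ ℓ-1
    F = frac (ℓ ^ suc a * ℓ ^ suc a) N
    1<ℓ^[a+1] : 1 < ℓ ^ suc a
    1<ℓ^[a+1] = ℕₚ.^-monoʳ-< ℓ 1<ℓ {0} {suc a} (s≤s z≤n)
    ℓ^[2a+2]<N : ℓ ^ suc a * ℓ ^ suc a < N
    ℓ^[2a+2]<N = subst (_< N) (ℕₚ.^-distribˡ-+-* ℓ (suc a) (suc a)) (ℕₚ.^-monoʳ-< ℓ 1<ℓ 2a+2<n)
    exponents : b + (suc a + suc a) ≡ a + n
    exponents = trans (solve 2 (λ a b → b :+ ((con 1 :+ a) :+ (con 1 :+ a))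
                                     := a :+ ((con 1 :+ a) :+ (con 1 :+ b))) refl a b)
                      (cong (λ j → a + j) a+b+2≡n)
      where open ℕ-Solver.+-*-Solver
    distribute : ∀ X l F → X ℚ.* (l ℚ.* (1ℚ - F)) ≡ l ℚ.* (X - X ℚ.* F)
    distribute = solve 3 (λ X l F → X :* (l :* (con 1ℚ :- F)) := l :* (X :- X :* F)) refl
      where open +-*-Solver
    powers : ℓ ^ b * (ℓ ^ suc a * ℓ ^ suc a) ≡ ℓ ^ a * N
    powers = begin
      ℓ ^ b * (ℓ ^ suc a * ℓ ^ suc a)   ≡⟨ cong (ℓ ^ b *_) (ℕₚ.^-distribˡ-+-* ℓ (suc a) (suc a)) ⟨
      ℓ ^ b * ℓ ^ (suc a + suc a)       ≡⟨ ℕₚ.^-distribˡ-+-* ℓ b (suc a + suc a) ⟨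
      ℓ ^ (b + (suc a + suc a))         ≡⟨ cong (ℓ ^_) exponents ⟩
      ℓ ^ (a + n)                       ≡⟨ ℕₚ.^-distribˡ-+-* ℓ a n ⟩
      ℓ ^ a * N                         ∎

  -- The valuations a + 1, …, m contribute; d = m − a.
  sumOverMultiples-telescope : ∀ m e → e ≤ 1 → n ≡ suc (m + e + m) → ∀ d a → a + d ≡ m →
    sumOverMultiples (suc a) (m + e + d)
      ≡ (ℕ→ℚ (ℓ ^ (m + e + d)) - ℕ→ℚ (ℓ ^ (m + e))) - (ℕ→ℚ (ℓ ^ m) - ℕ→ℚ (ℓ ^ a))
  sumOverMultiples-telescope m e e≤1 n≡ zero a a+0≡m with trans (sym (ℕₚ.+-identityʳ a)) a+0≡m
  ... | refl rewrite ℕₚ.+-identityʳ (a + e) = begin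
    sumOverMultiples (suc a) (a + e)
      ≡⟨ sumOverMultiples-vanish (suc a) (a + e) a+1+[a+e]≡n n≤2a+2 ⟩
    0ℚ
      ≡⟨ solve 2 (λ x y → con 0ℚ := (x :- x) :- (y :- y)) refl (ℕ→ℚ (ℓ ^ (a + e))) (ℕ→ℚ (ℓ ^ a)) ⟩
    (ℕ→ℚ (ℓ ^ (a + e)) - ℕ→ℚ (ℓ ^ (a + e))) - (ℕ→ℚ (ℓ ^ a) - ℕ→ℚ (ℓ ^ a)) ∎
    where
    open ≡-Reasoning
    open +-*-Solver
    a+1+[a+e]≡n : suc a + (a + e) ≡ n
    a+1+[a+e]≡n = sym (trans n≡ (cong suc (ℕₚ.+-comm (a + e) a)))
    n≤2a+2 : n ≤ suc a + suc a
    n≤2a+2 = ℕₚ.≤-trans (ℕₚ.≤-reflexive n≡)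
               (s≤s (ℕₚ.≤-trans (ℕₚ.+-monoˡ-≤ a (ℕₚ.+-monoʳ-≤ a e≤1)) (ℕₚ.≤-reflexive (ℕₚ.+-assoc a 1 a))))
  sumOverMultiples-telescope _ e e≤1 n≡ (suc d) a refl = begin
    sumOverMultiples (suc a) (m + e + suc d)
      ≡⟨ cong (sumOverMultiples (suc a)) (ℕₚ.+-suc (m + e) d) ⟩
    sumOverMultiples (suc a) (suc b)
      ≡⟨ sumOverMultiples-suc (suc a) b a+b+2≡n ⟩
    sumOverMultiples (suc (suc a)) b ℚ.+ X ℚ.* (l ℚ.* weight N (ℓ ^ suc a))
      ≡⟨ cong₂ ℚ._+_ (sumOverMultiples-telescope m e e≤1 n≡ d (suc a) (sym (ℕₚ.+-suc a d)))
                     (valuation-contribution a b a+b+2≡n 2a+2<n) ⟩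
    ((X - P) - (M - ℕ→ℚ (ℓ ^ suc a))) ℚ.+ l ℚ.* (X - A)
      ≡⟨ cong (λ y → ((X - P) - (M - y)) ℚ.+ l ℚ.* (X - A)) (ℕ→ℚ-ℓ^suc a) ⟩
    ((X - P) - (M - (l ℚ.+ 1ℚ) ℚ.* A)) ℚ.+ l ℚ.* (X - A)
      ≡⟨ regroup X P M l A ⟩
    ((l ℚ.+ 1ℚ) ℚ.* X - P) - (M - A)
      ≡⟨ cong (λ y → (y - P) - (M - A)) (ℕ→ℚ-ℓ^suc b) ⟨
    (ℕ→ℚ (ℓ ^ suc b) - P) - (M - A)
      ≡⟨ cong (λ j → (ℕ→ℚ (ℓ ^ j) - P) - (M - A)) (ℕₚ.+-suc (m + e) d) ⟨
    (ℕ→ℚ (ℓ ^ (m + e + suc d)) - P) - (M - A) ∎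
    where
    open ≡-Reasoning
    m = a + suc d
    b = m + e + d
    X = ℕ→ℚ (ℓ ^ b)
    P = ℕ→ℚ (ℓ ^ (m + e))
    M = ℕ→ℚ (ℓ ^ m)
    A = ℕ→ℚ (ℓ ^ a)
    l = ℕ→ℚ ℓ-1
    a+b+2≡n : suc a + suc b ≡ n
    a+b+2≡n = sym (trans n≡ (cong suc (solve 3 (λ a d e → a :+ (con 1 :+ d) :+ e :+ (a :+ (con 1 :+ d))
                                                := a :+ (con 1 :+ (a :+ (con 1 :+ d) :+ e :+ d))) refl a d e)))
      where open ℕ-Solver.+-*-Solver
    a+1≤m : suc a ≤ m
    a+1≤m = ℕₚ.≤-trans (s≤s (ℕₚ.m≤m+n a d)) (ℕₚ.≤-reflexive (sym (ℕₚ.+-suc a d)))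
    2a+2<n : suc a + suc a < n
    2a+2<n = subst (suc a + suc a <_) (sym n≡)
               (s≤s (ℕₚ.≤-trans (ℕₚ.+-mono-≤ a+1≤m a+1≤m) (ℕₚ.+-monoˡ-≤ m (ℕₚ.m≤m+n m e))))
    regroup : ∀ X P M l A → ((X - P) - (M - (l ℚ.+ 1ℚ) ℚ.* A)) ℚ.+ l ℚ.* (X - A)
                            ≡ ((l ℚ.+ 1ℚ) ℚ.* X - P) - (M - A)
    regroup = solve 5 (λ X P M l A → ((X :- P) :- (M :- (l :+ con 1ℚ) :* A)) :+ l :* (X :- A)
                                   := ((l :+ con 1ℚ) :* X :- P) :- (M :- A)) refl
      where open +-*-Solver

  S≡[ℓ^m-1]*[ℓ^[m+e]-1] : ∀ m e → e ≤ 1 → n ≡ suc (m + e + m) →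
                          S N μ ≡ (ℕ→ℚ (ℓ ^ m) - 1ℚ) ℚ.* (ℕ→ℚ (ℓ ^ (m + e)) - 1ℚ)
  S≡[ℓ^m-1]*[ℓ^[m+e]-1] m e e≤1 n≡ = begin
    S N μ
      ≡⟨ sumBelow-cong N (λ k _ → cong (S-summand N μ) (sym (ℕₚ.*-identityˡ k))) ⟩
    sumOverMultiples 0 n
      ≡⟨ cong (sumOverMultiples 0) n≡ ⟩
    sumOverMultiples 0 (suc (m + e + m))
      ≡⟨ sumOverMultiples-suc 0 (m + e + m) (sym n≡) ⟩
    -- valuation 0 contributes nothing: weight N (ℓ ^ 0) reduces to 0ℚ
    sumOverMultiples 1 (m + e + m) ℚ.+ X ℚ.* (l ℚ.* 0ℚ)
      ≡⟨ cong (ℚ._+ X ℚ.* (l ℚ.* 0ℚ)) (sumOverMultiples-telescope m e e≤1 n≡ m 0 refl) ⟩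
    ((X - P) - (M - 1ℚ)) ℚ.+ X ℚ.* (l ℚ.* 0ℚ)
      ≡⟨ cong (λ x → ((x - P) - (M - 1ℚ)) ℚ.+ x ℚ.* (l ℚ.* 0ℚ)) X≡M*P ⟩
    ((M ℚ.* P - P) - (M - 1ℚ)) ℚ.+ M ℚ.* P ℚ.* (l ℚ.* 0ℚ)
      ≡⟨ factorise M P l ⟩
    (M - 1ℚ) ℚ.* (P - 1ℚ) ∎
    where
    open ≡-Reasoning
    X = ℕ→ℚ (ℓ ^ (m + e + m))
    P = ℕ→ℚ (ℓ ^ (m + e))
    M = ℕ→ℚ (ℓ ^ m)
    l = ℕ→ℚ ℓ-1
    X≡M*P : X ≡ M ℚ.* P
    X≡M*P = trans (cong (ℕ→ℚ ∘ (ℓ ^_)) (ℕₚ.+-comm (m + e) m))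
                  (trans (cong ℕ→ℚ (ℕₚ.^-distribˡ-+-* ℓ m (m + e))) (ℕ→ℚ-* (ℓ ^ m) (ℓ ^ (m + e))))
    factorise : ∀ M P l → ((M ℚ.* P - P) - (M - 1ℚ)) ℚ.+ M ℚ.* P ℚ.* (l ℚ.* 0ℚ)
                          ≡ (M - 1ℚ) ℚ.* (P - 1ℚ)
    factorise = solve 3 (λ M P l → ((M :* P :- P) :- (M :- con 1ℚ)) :+ M :* P :* (l :* con 0ℚ)
                                 := (M :- con 1ℚ) :* (P :- con 1ℚ)) refl
      where open +-*-Solver

2*m+suc[e]≡suc[m+e+m] : ∀ m e → 2 * m + suc e ≡ suc (m + e + m)
2*m+suc[e]≡suc[m+e+m] = solve 2 (λ m e → con 2 :* m :+ (con 1 :+ e) := con 1 :+ (m :+ e :+ m)) refl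
  where open ℕ-Solver.+-*-Solver

mainTheorem15 : (ℓ n : ℕ) → Prime ℓ → 1 ≤ n → (μ : ℕ → ℕ) → IsMu (ℓ ^ n) μ →
    (∀ m → n ≡ 2 * m + 1 → S (ℓ ^ n) μ ≡ (ℕ→ℚ (ℓ ^ m) - 1ℚ) ℚ.* (ℕ→ℚ (ℓ ^ m) - 1ℚ)) ×
    (∀ m → n ≡ 2 * m + 2 → S (ℓ ^ n) μ ≡ (ℕ→ℚ (ℓ ^ m) - 1ℚ) ℚ.* (ℕ→ℚ (ℓ ^ (m + 1)) - 1ℚ))
mainTheorem15 zero        n ℓ-prime _ μ μ-spec = ⊥-elim (ℕ.≢-nonZero⁻¹ 0 {{prime⇒nonZero ℓ-prime}} refl)
mainTheorem15 (suc ℓ-1) n ℓ-prime _ μ μ-spec =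
  (λ m n≡2m+1 → subst (λ j → S N μ ≡ (ℕ→ℚ (ℓ ^ m) - 1ℚ) ℚ.* (ℕ→ℚ (ℓ ^ j) - 1ℚ)) (ℕₚ.+-identityʳ m)
                  (S≡[ℓ^m-1]*[ℓ^[m+e]-1] m 0 z≤n (trans n≡2m+1 (2*m+suc[e]≡suc[m+e+m] m 0)))) ,
  (λ m n≡2m+2 → S≡[ℓ^m-1]*[ℓ^[m+e]-1] m 1 ℕₚ.≤-refl (trans n≡2m+2 (2*m+suc[e]≡suc[m+e+m] m 1)))
  where open PrimePower ℓ-1 ℓ-prime n μ μ-spec
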